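{- Let $A:\mathcal{U}$ carry a cyclic structure $(\mathsf{pred}_A, n, w) : \mathsf{Cyclic}(A)$. Then for all $a,b : A$ there exists a unique natural number $k < n$ such that $\mathsf{pred}_A^{\,k}(a) = b$.
   Context: Work in homotopy type theory with a univalent universe $\mathcal{U}$ and propositional truncation $\|-\|$. $[n]$ is the standard finite type with elements $0,\dots,n-1$; for $n\ge1$, $\mathsf{pred}:[n]\to[n]$ sends $0\mapsto n-1$ and $i+1\mapsto i$. The type of cyclic structures on $A$ is $\mathsf{Cyclic}(A) :\equiv \sum_{\varphi : A \to A}\sum_{n:\mathbb{N}} \big\| \sum_{e : A \simeq [n]} e\circ\varphi = \mathsf{pred}\circ e \big\|$; $\mathsf{pred}_A$ denotes the function component $\varphi$, and $\mathsf{pred}_A^k$ its $k$-fold iterate. -}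

module Defs where

open import Level using (Level) renaming (suc to lsuc)
open import Data.Nat using (ℕ; zero; suc)
open import Data.Fin using (Fin; zero; suc; fromℕ; inject₁)
open import Data.Product using (Σ; Σ-syntax; _,_)
open import Function using (_∘_; id)
open import Function.Bundles using (_↔_; Inverse)
open import Relation.Binary.PropositionalEquality using (_≡_)

isProp : ∀ {ℓ} → Set ℓ → Set ℓ
isProp P = (x y : P) → x ≡ y

-- Propositional truncation, impredicative encoding (eliminates into all
-- propositions of the same universe).
∥_∥ : ∀ {ℓ} → Set ℓ → Set (lsuc ℓ)
∥_∥ {ℓ} X = (P : Set ℓ) → isProp P → (X → P) → P

predFin : (n : ℕ) → Fin n → Fin n
predFin (suc m) zero    = fromℕ m
predFin (suc m) (suc i) = inject₁ i

iter : ∀ {ℓ} {A : Set ℓ} → (A → A) → ℕ → A → A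
iter f zero    = id
iter f (suc k) = f ∘ iter f k

Cyclic : ∀ {ℓ} → Set ℓ → Set (lsuc ℓ)
Cyclic A =
  Σ[ φ ∈ (A → A) ] Σ[ n ∈ ℕ ]
    ∥ Σ[ e ∈ A ↔ Fin n ] (Inverse.to e ∘ φ ≡ predFin n ∘ Inverse.to e) ∥

predOf : ∀ {ℓ} {A : Set ℓ} → Cyclic A → A → A
predOf (φ , _ , _) = φ

sizeOf : ∀ {ℓ} {A : Set ℓ} → Cyclic A → ℕ
sizeOf (_ , n , _) = n

{-# OPTIONS --safe #-}
-- On [n], pred lowers an index by one and wraps 0 to n - 1, so for k < n we have
-- pred^k i = j exactly when j + k is i or i + n: the sum wraps around at most once.
-- This determines k from i and j, and choosing k = i - j or k = i + n - j shows it
-- exists. Both facts transfer to A along an equivalence e with e ∘ pred_A = pred ∘ e.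
-- The equivalence is only known to exist merely, but uniqueness of k makes
-- Σ k. (k < n × pred_A^k a = b) a proposition (its path component by axiom K), so the
-- truncation can be eliminated into it.
module Submission where

open import Defs
open import Level using (Level; Lift; lift; lower)
open import Data.Nat using (ℕ; zero; suc; _+_; _∸_; _≤_; _<_; _≤?_; s≤s; s≤s⁻¹)
open import Data.Nat.Properties
open import Data.Fin using (Fin; zero; suc; toℕ; fromℕ)
open import Data.Fin.Properties using (toℕ-injective; toℕ<n; toℕ-inject₁; toℕ-fromℕ)
open import Data.Product using (Σ; Σ-syntax; ∃!; _×_; _,_; proj₁; proj₂)
open import Data.Sum using (_⊎_; inj₁; inj₂)
open import Data.Empty using (⊥; ⊥-elim)
open import Relation.Nullary using (yes; no)
open import Function using (_∘_)
open import Function.Bundles using (_↔_; Inverse; Injection)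
open import Function.Properties.Inverse using (↔⇒↣)
open import Axiom.UniquenessOfIdentityProofs.WithK using (uip)
open import Relation.Binary.PropositionalEquality

iter-+ : ∀ {a} {A : Set a} (f : A → A) m n x → iter f (m + n) x ≡ iter f m (iter f n x)
iter-+ f zero    n x = refl
iter-+ f (suc m) n x = cong f (iter-+ f m n x)

iter-commute : ∀ {a b} {A : Set a} {B : Set b} {φ : A → A} {ψ : B → B} (f : A → B) →
               (∀ x → f (φ x) ≡ ψ (f x)) → ∀ k x → f (iter φ k x) ≡ iter ψ k (f x)
iter-commute f comm zero    x = refl
iter-commute {ψ = ψ} f comm (suc k) x = trans (comm _) (cong ψ (iter-commute f comm k x))

Σ-isProp-unique : ∀ {a b} {A : Set a} {P : A → Set b} → (∀ x → isProp (P x)) →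
                  (∀ {x y} → P x → P y → x ≡ y) → isProp (Σ A P)
Σ-isProp-unique isProp-P unique (x , p) (y , q) with unique p q
... | refl = cong (x ,_) (isProp-P x p q)

no-double-wrap : ∀ {n x i k k'} → x + k ≡ i → x + k' ≡ i + n → k' < n → ⊥
no-double-wrap {n} {x} {i} {k} {k'} p q k'<n = m+n≮n k n (subst (_< n) k'≡k+n k'<n)
  where
  k'≡k+n : k' ≡ k + n
  k'≡k+n = +-cancelˡ-≡ x k' (k + n) (trans q (trans (cong (_+ n) (sym p)) (+-assoc x k n)))

offset-unique : ∀ {n x i k k'} → k < n → k' < n →
                x + k ≡ i ⊎ x + k ≡ i + n → x + k' ≡ i ⊎ x + k' ≡ i + n → k ≡ k'
offset-unique {x = x} {k = k} {k'} _ _ (inj₁ p) (inj₁ q) = +-cancelˡ-≡ x k k' (trans p (sym q))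
offset-unique {x = x} {k = k} {k'} _ _ (inj₂ p) (inj₂ q) = +-cancelˡ-≡ x k k' (trans p (sym q))
offset-unique _   k'<n (inj₁ p) (inj₂ q) = ⊥-elim (no-double-wrap p q k'<n)
offset-unique k<n _    (inj₂ p) (inj₁ q) = ⊥-elim (no-double-wrap q p k<n)

toℕ-iter-predFin : ∀ {n} (i : Fin n) {k} → k ≤ toℕ i → toℕ (iter (predFin n) k i) + k ≡ toℕ i
toℕ-iter-predFin i {zero} _ = +-identityʳ (toℕ i)
toℕ-iter-predFin {n} i {suc k} k<i with iter (predFin n) k i | toℕ-iter-predFin i (<⇒≤ k<i)
... | zero  | k≡i   = ⊥-elim (<-irrefl k≡i k<i)
... | suc x | x+k≡i = trans (cong (_+ suc k) (toℕ-inject₁ x)) (trans (+-suc (toℕ x) k) x+k≡i)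

iter-predFin-wrap : ∀ {m} (i : Fin (suc m)) → iter (predFin (suc m)) (suc (toℕ i)) i ≡ fromℕ m
iter-predFin-wrap {m} i = cong (predFin (suc m)) (toℕ-injective x≡0)
  where
  x≡0 : toℕ (iter (predFin (suc m)) (toℕ i) i) ≡ 0
  x≡0 = +-cancelʳ-≡ (toℕ i) _ 0 (toℕ-iter-predFin i ≤-refl)

toℕ-iter-predFin-wrapped : ∀ {m} (i : Fin (suc m)) {d} → d ≤ m →
                           toℕ (iter (predFin (suc m)) (d + suc (toℕ i)) i) + d ≡ m
toℕ-iter-predFin-wrapped {m} i {d} d≤m = begin
  toℕ (iter (predFin (suc m)) (d + suc (toℕ i)) i) + d
    ≡⟨ cong (λ y → toℕ y + d) (iter-+ (predFin (suc m)) d (suc (toℕ i)) i) ⟩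
  toℕ (iter (predFin (suc m)) d (iter (predFin (suc m)) (suc (toℕ i)) i)) + d
    ≡⟨ cong (λ y → toℕ (iter (predFin (suc m)) d y) + d) (iter-predFin-wrap i) ⟩
  toℕ (iter (predFin (suc m)) d (fromℕ m)) + d
    ≡⟨ toℕ-iter-predFin (fromℕ m) (subst (d ≤_) (sym (toℕ-fromℕ m)) d≤m) ⟩
  toℕ (fromℕ m)
    ≡⟨ toℕ-fromℕ m ⟩
  m ∎
  where open ≡-Reasoning

toℕ-iter-predFin-offset : ∀ {m} (i : Fin (suc m)) {k} → k < suc m →
  toℕ (iter (predFin (suc m)) k i) + k ≡ toℕ i ⊎
  toℕ (iter (predFin (suc m)) k i) + k ≡ toℕ i + suc m
toℕ-iter-predFin-offset {m} i {k} k<n with k ≤? toℕ i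
... | yes k≤i = inj₁ (toℕ-iter-predFin i k≤i)
... | no  k≰i = inj₂ (subst (λ k → toℕ (iter (predFin (suc m)) k i) + k ≡ toℕ i + suc m)
                            (m∸n+n≡m (≰⇒> k≰i)) (wrapped (m∸n≤m k (suc (toℕ i)))))
  where
  wrapped : ∀ {d} → d ≤ k → toℕ (iter (predFin (suc m)) (d + suc (toℕ i)) i) + (d + suc (toℕ i))
                              ≡ toℕ i + suc m
  wrapped {d} d≤k = begin
    x + (d + suc (toℕ i)) ≡⟨ +-assoc x d (suc (toℕ i)) ⟨
    (x + d) + suc (toℕ i) ≡⟨ cong (_+ suc (toℕ i)) (toℕ-iter-predFin-wrapped i d≤m) ⟩
    m + suc (toℕ i)       ≡⟨ +-comm m (suc (toℕ i)) ⟩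
    suc (toℕ i + m)       ≡⟨ +-suc (toℕ i) m ⟨
    toℕ i + suc m         ∎
    where
    open ≡-Reasoning
    x : ℕ
    x = toℕ (iter (predFin (suc m)) (d + suc (toℕ i)) i)
    d≤m : d ≤ m
    d≤m = ≤-trans d≤k (s≤s⁻¹ k<n)

predFin-reaches : ∀ {m} (i j : Fin (suc m)) →
                  Σ[ k ∈ ℕ ] k < suc m × iter (predFin (suc m)) k i ≡ j
predFin-reaches {m} i j with toℕ j ≤? toℕ i
... | yes j≤i = k , ≤-<-trans (m∸n≤m (toℕ i) (toℕ j)) (toℕ<n i) , toℕ-injective x≡j
  where
  k = toℕ i ∸ toℕ j
  x≡j : toℕ (iter (predFin (suc m)) k i) ≡ toℕ j
  x≡j = +-cancelʳ-≡ k _ (toℕ j)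
          (trans (toℕ-iter-predFin i (m∸n≤m (toℕ i) (toℕ j))) (sym (m+[n∸m]≡n j≤i)))
... | no  j≰i = d + suc (toℕ i) , s≤s k≤m , toℕ-injective x≡j
  where
  j≤m : toℕ j ≤ m
  j≤m = s≤s⁻¹ (toℕ<n j)
  d = m ∸ toℕ j
  k≤m : d + suc (toℕ i) ≤ m
  k≤m = ≤-trans (+-monoʳ-≤ d (≰⇒> j≰i)) (≤-reflexive (m∸n+n≡m j≤m))
  x≡j : toℕ (iter (predFin (suc m)) (d + suc (toℕ i)) i) ≡ toℕ j
  x≡j = +-cancelʳ-≡ d _ (toℕ j)
          (trans (toℕ-iter-predFin-wrapped i (m∸n≤m m (toℕ j))) (sym (m+[n∸m]≡n j≤m)))

predFin-∃! : ∀ n (i j : Fin n) → ∃! _≡_ (λ k → k < n × iter (predFin n) k i ≡ j)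
predFin-∃! (suc m) i j with predFin-reaches i j
... | k , k<n , reaches = k , (k<n , reaches) , λ (k'<n , reaches') →
  offset-unique k<n k'<n (offset k<n reaches) (offset k'<n reaches')
  where
  offset : ∀ {k} → k < suc m → iter (predFin (suc m)) k i ≡ j →
           toℕ j + k ≡ toℕ i ⊎ toℕ j + k ≡ toℕ i + suc m
  offset k<n refl = toℕ-iter-predFin-offset i k<n

iter-∃!-transfer : ∀ {a b} {A : Set a} {B : Set b} (e : A ↔ B) {φ : A → A} {ψ : B → B} →
  (∀ x → Inverse.to e (φ x) ≡ ψ (Inverse.to e x)) → ∀ {n} x y →
  ∃! _≡_ (λ k → k < n × iter ψ k (Inverse.to e x) ≡ Inverse.to e y) →
  ∃! _≡_ (λ k → k < n × iter φ k x ≡ y)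
iter-∃!-transfer e {φ} {ψ} comm x y (k , (k<n , reaches) , unique) =
  k , (k<n , Injection.injective (↔⇒↣ e) (trans (to-iter k) reaches)) ,
  λ {k'} (k'<n , reaches') → unique (k'<n , trans (sym (to-iter k')) (cong (Inverse.to e) reaches'))
  where
  to-iter : ∀ k → Inverse.to e (iter φ k x) ≡ iter ψ k (Inverse.to e x)
  to-iter k = iter-commute (Inverse.to e) comm k x

lemma2p11 : ∀ {ℓ : Level} {A : Set ℓ} (c : Cyclic A) (a b : A) →
              ∃! _≡_ (λ (k : ℕ) → k < sizeOf c × iter (predOf c) k a ≡ b)
lemma2p11 {ℓ} {A} (φ , n , w) a b = proj₁ witness , proj₂ witness , unique (proj₂ witness)
  where
  Steps : ℕ → Set ℓ
  Steps k = k < n × iter φ k a ≡ b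

  from-equivalence : Σ[ e ∈ A ↔ Fin n ] (Inverse.to e ∘ φ ≡ predFin n ∘ Inverse.to e) →
                     ∃! _≡_ Steps
  from-equivalence (e , comm) = iter-∃!-transfer e (cong-app comm) a b (predFin-∃! n _ _)

  unique : ∀ {k k'} → Steps k → Steps k' → k ≡ k'
  unique {k} {k'} p q = lower (w (Lift ℓ (k ≡ k')) (λ _ _ → cong lift (uip _ _)) λ c →
    let (_ , _ , unique-k) = from-equivalence c in lift (trans (sym (unique-k p)) (unique-k q)))

  witness : Σ ℕ Steps
  witness = w (Σ ℕ Steps) (Σ-isProp-unique isProp-Steps unique) λ c →
    let (k , steps , _) = from-equivalence c in k , steps
    where
    isProp-Steps : ∀ k → isProp (Steps k)
    isProp-Steps _ (l , p) (l' , p') = cong₂ _,_ (<-irrelevant l l') (uip p p')
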